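{- Let $n$ keys be stored in a linear probing table of size $t = 2n$ using a hash function drawn from any 2-independent family $h:[u]\to[t]$, and let $q$ be a key not among the stored keys. Then the expected time of an (unsuccessful) search for $q$ is $O(\sqrt{n})$.
   Context: A family of functions $h:[u]\to[t]$ is $k$-independent if for any distinct $x_1,\dots,x_k\in[u]$ the values $h(x_1),\dots,h(x_k)$ are independent and each $h(x)$ is uniform on $[t]=\{0,\dots,t-1\}$. Linear probing: the table is an array of $t$ cells indexed cyclically; to insert $x$, the cells $h(x),h(x)+1,\dots$ (mod $t$) are scanned and $x$ is placed in the first empty cell. A search for a key $q$ not in the table scans from $h(q)$ up to the first empty cell; its time is the number of cells considered. -}

module Defs where

open import Data.Nat using (ℕ; zero; suc; _+_; _*_; _<?_; s≤s)
open import Data.Fin using (Fin; zero; suc; toℕ; fromℕ<; _≟_)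
open import Data.Maybe using (Maybe; just; nothing)
open import Data.List using (List; []; _∷_; foldl; length; filter; map)
open import Data.Nat.ListAction using (sum)
open import Relation.Nullary using (¬_)
open import Data.Product using (_×_)
open import Relation.Nullary using (yes; no)
open import Relation.Nullary.Decidable using (_×-dec_)
open import Relation.Binary.PropositionalEquality using (_≡_)

HashFn : ℕ → ℕ → Set
HashFn u t = Fin u → Fin t

-- A hash family is a finite list (multiset) of hash functions; a random
-- hash function is drawn uniformly from this list.
Family : ℕ → ℕ → Set
Family u t = List (HashFn u t)

count₁ : ∀ {u t} → Family u t → Fin u → Fin t → ℕ
count₁ H x a = length (filter (λ h → h x ≟ a) H)

count₂ : ∀ {u t} → Family u t → Fin u → Fin u → Fin t → Fin t → ℕ
count₂ H x₁ x₂ a b = length (filter (λ h → (h x₁ ≟ a) ×-dec (h x₂ ≟ b)) H)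

TwoIndependent : ∀ {u t} → Family u t → Set
TwoIndependent {u} {t} H =
  ((x : Fin u) (a : Fin t) → count₁ H x a * t ≡ length H) ×
  ((x₁ x₂ : Fin u) → ¬ (x₁ ≡ x₂) → (a b : Fin t) → count₂ H x₁ x₂ a b * (t * t) ≡ length H)

next : ∀ {t} → Fin t → Fin t
next {suc k} i with suc (toℕ i) <? suc k
... | yes p = fromℕ< p
... | no _  = zero

Table : ℕ → ℕ → Set
Table u t = Fin t → Maybe (Fin u)

emptyTable : ∀ {u t} → Table u t
emptyTable _ = nothing

write : ∀ {u t} → Table u t → Fin t → Fin u → Table u t
write T i x j with j ≟ i
... | yes _ = just x
... | no _  = T j

place : ∀ {u t} → Table u t → Fin t → ℕ → Fin u → Table u t
place T i zero x = T
place T i (suc f) x with T i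
... | nothing = write T i x
... | just _  = place T (next i) f x

insert : ∀ {u t} → HashFn u t → Table u t → Fin u → Table u t
insert {t = t} h T x = place T (h x) t x

build : ∀ {u t} → HashFn u t → List (Fin u) → Table u t
build h keys = foldl (insert h) emptyTable keys

scanTime : ∀ {u t} → Table u t → Fin t → ℕ → ℕ
scanTime T i zero = 0
scanTime T i (suc f) with T i
... | nothing = 1
... | just _  = suc (scanTime T (next i) f)

searchTime : ∀ {u t} → HashFn u t → List (Fin u) → Fin u → ℕ
searchTime {t = t} h keys q = scanTime (build h keys) (h q) t

-- sum over the family of the search time; the expected search time is
-- totalSearchTime H keys q / length H
totalSearchTime : ∀ {u t} → Family u t → List (Fin u) → Fin u → ℕ
totalSearchTime H keys q = sum (map (λ h → searchTime h keys q) H)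

-- If an unsuccessful search from cell h q scans more than ℓ cells, these cells
-- lie in a run of m ≥ ℓ occupied cells following an empty cell, and at least m
-- keys hash into such a run.  Cutting the table into aligned blocks of length
-- b = ⌊ℓ / 15⌋, some block meeting the run then receives more than 7b/8 keys,
-- whereas at load factor 1/2 it receives b/2 in expectation.  By
-- 2-independence the block load has variance at most b/2, so Chebyshev bounds
-- the probability of overloading a given block by O(1/b); a union bound over
-- the O(n/b) relevant blocks gives Pr[search time > ℓ] = O(n/ℓ²).  Summing this
-- tail from ℓ ≈ √n on gives an expected search time O(√n).
module Submission where

open import Defs
open import Data.Nat using (ℕ; zero; suc; _+_; _*_; _∸_; _≤_; _<_; _≤?_; _<?_; z≤n; s≤s; z<s; s<s; _/_; _%_; NonZero; >-nonZero)
open import Data.Nat.Properties hiding (_≟_)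
open import Data.Nat.DivMod using (m≡m%n+[m/n]*n; m%n<n; m/n*n≤m; m/n≤m; /-monoˡ-≤; m≥n⇒m/n>0)
open import Data.Nat.Induction using (<-rec)
open import Data.Nat.ListAction using (sum)
open import Data.Nat.Tactic.RingSolver using (solve-∀)
open import Data.Fin using (Fin; zero; toℕ; _≟_)
open import Data.Fin.Properties using (toℕ-fromℕ<; toℕ-injective; toℕ<n)
open import Data.Maybe using (Maybe; just; nothing)
open import Data.List using (List; []; _∷_; [_]; _∷ʳ_; _++_; foldl; length; filter; map)
open import Data.List.Properties using (length-++; ++-assoc; ++-identityʳ)
open import Data.List.Relation.Unary.All as All using (All; []; _∷_)
open import Data.List.Relation.Unary.AllPairs using ([]; _∷_)
open import Data.List.Relation.Unary.Any using (here; there)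
open import Data.List.Relation.Unary.Unique.Propositional using (Unique)
open import Data.List.Membership.Propositional using (_∈_; _∉_)
open import Data.Product using (_×_; _,_; ∃; ∃₂; proj₁; proj₂)
open import Data.Sum using (_⊎_; inj₁; inj₂)
open import Data.Empty using (⊥-elim)
open import Function using (_∘_)
open import Relation.Nullary using (¬_; Dec; yes; no; contradiction)
open import Relation.Nullary.Decidable using (_×-dec_)
open import Relation.Unary using (Decidable)
open import Relation.Binary.PropositionalEquality hiding ([_])
open import Algebra.Properties.CommutativeSemigroup +-commutativeSemigroup
  using () renaming (interchange to +-interchange)
open import Algebra.Properties.CommutativeSemigroup *-commutativeSemigroup using (xy∙z≈xz∙y)

𝟙 : ∀ {p} {P : Set p} → Dec P → ℕ
𝟙 (yes _) = 1
𝟙 (no _)  = 0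

𝟙-yes : ∀ {p} {P : Set p} (P? : Dec P) → P → 𝟙 P? ≡ 1
𝟙-yes (yes _) _ = refl
𝟙-yes (no ¬p) p = contradiction p ¬p

𝟙-no : ∀ {p} {P : Set p} (P? : Dec P) → ¬ P → 𝟙 P? ≡ 0
𝟙-no (yes p) ¬p = contradiction p ¬p
𝟙-no (no _)  _  = refl

𝟙-×-dec : ∀ {p q} {P : Set p} {Q : Set q} (P? : Dec P) (Q? : Dec Q) →
          𝟙 (P? ×-dec Q?) ≡ 𝟙 P? * 𝟙 Q?
𝟙-×-dec (yes _) (yes _) = refl
𝟙-×-dec (yes _) (no _)  = refl
𝟙-×-dec (no _)  (yes _) = refl
𝟙-×-dec (no _)  (no _)  = refl

module _ {a} {A : Set a} where

  ∑ : List A → (A → ℕ) → ℕ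
  ∑ xs f = sum (map f xs)

  ∑-cong : ∀ xs {f g : A → ℕ} → (∀ x → f x ≡ g x) → ∑ xs f ≡ ∑ xs g
  ∑-cong []       f≗g = refl
  ∑-cong (x ∷ xs) f≗g = cong₂ _+_ (f≗g x) (∑-cong xs f≗g)

  ∑-mono : ∀ xs {f g : A → ℕ} → (∀ x → f x ≤ g x) → ∑ xs f ≤ ∑ xs g
  ∑-mono []       f≤g = z≤n
  ∑-mono (x ∷ xs) f≤g = +-mono-≤ (f≤g x) (∑-mono xs f≤g)

  ∑-mono-∈ : ∀ xs {f g : A → ℕ} → (∀ {x} → x ∈ xs → f x ≤ g x) → ∑ xs f ≤ ∑ xs g
  ∑-mono-∈ []       f≤g = z≤n
  ∑-mono-∈ (x ∷ xs) f≤g = +-mono-≤ (f≤g (here refl)) (∑-mono-∈ xs (λ x∈ → f≤g (there x∈)))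

  ∑-const : ∀ xs c → ∑ xs (λ _ → c) ≡ length xs * c
  ∑-const []       c = refl
  ∑-const (x ∷ xs) c = cong (c +_) (∑-const xs c)

  ∑-zero : ∀ xs → ∑ xs (λ _ → 0) ≡ 0
  ∑-zero xs = trans (∑-const xs 0) (*-zeroʳ (length xs))

  ∑-All-≤ : ∀ xs {f : A → ℕ} {c} → All (λ x → f x ≤ c) xs → ∑ xs f ≤ length xs * c
  ∑-All-≤ []       []         = z≤n
  ∑-All-≤ (x ∷ xs) (fx≤ ∷ f≤) = +-mono-≤ fx≤ (∑-All-≤ xs f≤)

  ∑-distrib-+ : ∀ xs (f g : A → ℕ) → ∑ xs (λ x → f x + g x) ≡ ∑ xs f + ∑ xs g
  ∑-distrib-+ []       f g = refl
  ∑-distrib-+ (x ∷ xs) f g rewrite ∑-distrib-+ xs f g = +-interchange (f x) (g x) (∑ xs f) (∑ xs g)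

  ∑-*ˡ : ∀ xs c (f : A → ℕ) → ∑ xs (λ x → c * f x) ≡ c * ∑ xs f
  ∑-*ˡ []       c f = sym (*-zeroʳ c)
  ∑-*ˡ (x ∷ xs) c f rewrite ∑-*ˡ xs c f = sym (*-distribˡ-+ c (f x) (∑ xs f))

  ∑-*ʳ : ∀ xs c (f : A → ℕ) → ∑ xs (λ x → f x * c) ≡ ∑ xs f * c
  ∑-*ʳ xs c f = begin
    ∑ xs (λ x → f x * c) ≡⟨ ∑-cong xs (λ x → *-comm (f x) c) ⟩
    ∑ xs (λ x → c * f x) ≡⟨ ∑-*ˡ xs c f ⟩
    c * ∑ xs f           ≡⟨ *-comm c (∑ xs f) ⟩
    ∑ xs f * c           ∎
    where open ≡-Reasoning

  ∑-++ : ∀ xs ys (f : A → ℕ) → ∑ (xs ++ ys) f ≡ ∑ xs f + ∑ ys f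
  ∑-++ []       ys f = refl
  ∑-++ (x ∷ xs) ys f rewrite ∑-++ xs ys f = sym (+-assoc (f x) (∑ xs f) (∑ ys f))

  length-filter≡∑𝟙 : ∀ {p} {P : A → Set p} (P? : ∀ x → Dec (P x)) xs →
                     length (filter P? xs) ≡ ∑ xs (λ x → 𝟙 (P? x))
  length-filter≡∑𝟙 P? []       = refl
  length-filter≡∑𝟙 P? (x ∷ xs) with P? x
  ... | yes _ = cong suc (length-filter≡∑𝟙 P? xs)
  ... | no _  = length-filter≡∑𝟙 P? xs

∑-comm : ∀ {a b} {A : Set a} {B : Set b} xs ys (f : A → B → ℕ) →
         ∑ xs (λ x → ∑ ys (f x)) ≡ ∑ ys (λ y → ∑ xs (λ x → f x y))
∑-comm []       ys f = sym (∑-zero ys)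
∑-comm (x ∷ xs) ys f rewrite ∑-comm xs ys f = sym (∑-distrib-+ ys (f x) _)

segSum : (ℕ → ℕ) → ℕ → ℕ → ℕ
segSum f a zero    = 0
segSum f a (suc m) = f a + segSum f (suc a) m

private
  at-start : ∀ {ℓ} (P : ℕ → Set ℓ) a m → (∀ i → i < suc m → P (a + i)) → P a
  at-start P a m p = subst P (+-identityʳ a) (p 0 z<s)

  on-rest : ∀ {ℓ} (P : ℕ → Set ℓ) a m → (∀ i → i < suc m → P (a + i)) → ∀ i → i < m → P (suc a + i)
  on-rest P a m p i i<m = subst P (+-suc a i) (p (suc i) (s<s i<m))

segSum-cong : ∀ {f g} a m → (∀ i → f i ≡ g i) → segSum f a m ≡ segSum g a m
segSum-cong a zero    f≗g = refl
segSum-cong a (suc m) f≗g = cong₂ _+_ (f≗g a) (segSum-cong (suc a) m f≗g)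

segSum-≤-const : ∀ {f} a m c → (∀ i → i < m → f (a + i) ≤ c) → segSum f a m ≤ m * c
segSum-≤-const {f} a zero    c f≤c = z≤n
segSum-≤-const {f} a (suc m) c f≤c =
  +-mono-≤ (at-start P a m f≤c) (segSum-≤-const (suc a) m c (on-rest P a m f≤c))
  where P = λ i → f i ≤ c

segSum-const : ∀ {f} a m c → (∀ i → f i ≡ c) → segSum f a m ≡ m * c
segSum-const a zero    c f≡c = refl
segSum-const a (suc m) c f≡c = cong₂ _+_ (f≡c a) (segSum-const (suc a) m c f≡c)

segSum-zero : ∀ {f} a m → (∀ i → i < m → f (a + i) ≡ 0) → segSum f a m ≡ 0
segSum-zero {f} a zero    f≡0 = refl
segSum-zero {f} a (suc m) f≡0 =
  cong₂ _+_ (at-start P a m f≡0) (segSum-zero (suc a) m (on-rest P a m f≡0))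
  where P = λ i → f i ≡ 0

term≤segSum : ∀ f a m i → i < m → f (a + i) ≤ segSum f a m
term≤segSum f a (suc m) zero    _         rewrite +-identityʳ a = m≤m+n (f a) _
term≤segSum f a (suc m) (suc i) (s<s i<m) rewrite +-suc a i =
  ≤-trans (term≤segSum f (suc a) m i i<m) (m≤n+m _ (f a))

segSum-split : ∀ f a m m′ → segSum f a (m + m′) ≡ segSum f a m + segSum f (a + m) m′
segSum-split f a zero    m′ rewrite +-identityʳ a = refl
segSum-split f a (suc m) m′ rewrite segSum-split f (suc a) m m′ | +-suc a m =
  sym (+-assoc (f a) (segSum f (suc a) m) _)

segSum-distrib-+ : ∀ f g a m → segSum (λ i → f i + g i) a m ≡ segSum f a m + segSum g a m
segSum-distrib-+ f g a zero    = refl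
segSum-distrib-+ f g a (suc m) rewrite segSum-distrib-+ f g (suc a) m =
  +-interchange (f a) (g a) (segSum f (suc a) m) (segSum g (suc a) m)

segSum-*ˡ : ∀ c f a m → segSum (λ i → c * f i) a m ≡ c * segSum f a m
segSum-*ˡ c f a zero    = sym (*-zeroʳ c)
segSum-*ˡ c f a (suc m) rewrite segSum-*ˡ c f (suc a) m = sym (*-distribˡ-+ c (f a) _)

segSum-*ʳ : ∀ c f a m → segSum (λ i → f i * c) a m ≡ segSum f a m * c
segSum-*ʳ c f a m = begin
  segSum (λ i → f i * c) a m ≡⟨ segSum-cong a m (λ i → *-comm (f i) c) ⟩
  segSum (λ i → c * f i) a m ≡⟨ segSum-*ˡ c f a m ⟩
  c * segSum f a m           ≡⟨ *-comm c _ ⟩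
  segSum f a m * c           ∎
  where open ≡-Reasoning

*-segSum-const : ∀ c g a m v → (∀ i → c * g i ≡ v) → c * segSum g a m ≡ m * v
*-segSum-const c g a m v c*g≡v = trans (sym (segSum-*ˡ c g a m)) (segSum-const a m v c*g≡v)

segSum-∑ : ∀ {b} {B : Set b} (xs : List B) (f : ℕ → B → ℕ) a m →
           segSum (λ i → ∑ xs (f i)) a m ≡ ∑ xs (λ x → segSum (λ i → f i x) a m)
segSum-∑ xs f a zero    = sym (∑-zero xs)
segSum-∑ xs f a (suc m) rewrite segSum-∑ xs f (suc a) m = sym (∑-distrib-+ xs (f a) _)

segSum-sub : ∀ f {a m a′ m′} → a′ ≤ a → a + m ≤ a′ + m′ → segSum f a m ≤ segSum f a′ m′
segSum-sub f {a} {m} {a′} {m′} a′≤a end≤ with d , refl ← m≤n⇒∃[o]m+o≡n a′≤a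
  with e , d+m+e≡m′ ← m≤n⇒∃[o]m+o≡n (+-cancelˡ-≤ a′ (d + m) m′ (subst (_≤ a′ + m′) (+-assoc a′ d m) end≤)) =
  begin
  segSum f (a′ + d) m                                     ≤⟨ m≤n+m _ _ ⟩
  segSum f a′ d + segSum f (a′ + d) m                     ≡⟨ segSum-split f a′ d m ⟨
  segSum f a′ (d + m)                                     ≤⟨ m≤m+n _ _ ⟩
  segSum f a′ (d + m) + segSum f (a′ + (d + m)) e         ≡⟨ segSum-split f a′ (d + m) e ⟨
  segSum f a′ (d + m + e)                                 ≡⟨ cong (segSum f a′) d+m+e≡m′ ⟩
  segSum f a′ m′                                          ∎
  where open ≤-Reasoning

next-cases : ∀ {t′} (i : Fin (suc t′)) →
             (toℕ (next i) ≡ suc (toℕ i) × suc (toℕ i) < suc t′) ⊎ (toℕ i ≡ t′ × next i ≡ zero)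
next-cases {t′} i with suc (toℕ i) <? suc t′
... | yes i+1<t = inj₁ (toℕ-fromℕ< i+1<t , i+1<t)
... | no  i+1≮t = inj₂ (≤-antisym (≤-pred (toℕ<n i)) (≤-pred (≮⇒≥ i+1≮t)) , refl)

next-injective : ∀ {t′} {i j : Fin (suc t′)} → next i ≡ next j → i ≡ j
next-injective {i = i} {j} eq with next-cases i | next-cases j
... | inj₁ (i′ , _) | inj₁ (j′ , _) = toℕ-injective (suc-injective (trans (sym i′) (trans (cong toℕ eq) j′)))
... | inj₂ (i′ , _) | inj₂ (j′ , _) = toℕ-injective (trans i′ (sym j′))
... | inj₁ (i′ , _) | inj₂ (_ , j′) = contradiction (trans (sym i′) (cong toℕ (trans eq j′))) (λ ())
... | inj₂ (_ , i′) | inj₁ (j′ , _) = contradiction (trans (sym j′) (cong toℕ (trans (sym eq) i′))) (λ ())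

-- Cells are addressed by natural numbers read modulo t, so that runs of cells
-- wrapping around the end of the table are ordinary segments [a, a + m).
module Cells (t′ : ℕ) where

  t : ℕ
  t = suc t′

  cell : ℕ → Fin t
  cell zero    = zero
  cell (suc i) = next (cell i)

  toℕ-cell : ∀ {i} → i < t → toℕ (cell i) ≡ i
  toℕ-cell {zero}  _     = refl
  toℕ-cell {suc i} i+1<t with next-cases (cell i)
  ... | inj₁ (eq , _) = trans eq (cong suc (toℕ-cell (<⇒≤ i+1<t)))
  ... | inj₂ (eq , _) = contradiction (subst (λ k → suc k < t) (trans (sym (toℕ-cell (<⇒≤ i+1<t))) eq) i+1<t)
                                      (<-irrefl refl)

  cell-toℕ : ∀ (c : Fin t) → cell (toℕ c) ≡ c
  cell-toℕ c = toℕ-injective (toℕ-cell (toℕ<n c))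

  cell-t : cell t ≡ zero
  cell-t with next-cases (cell t′)
  ... | inj₁ (_ , last<t) = contradiction (subst (λ k → suc k < t) (toℕ-cell ≤-refl) last<t) (<-irrefl refl)
  ... | inj₂ (_ , eq)     = eq

  cell-+ʳ : ∀ x y z → cell x ≡ cell y → cell (x + z) ≡ cell (y + z)
  cell-+ʳ x y zero    eq rewrite +-identityʳ x | +-identityʳ y = eq
  cell-+ʳ x y (suc z) eq rewrite +-suc x z | +-suc y z = cong next (cell-+ʳ x y z eq)

  cell-+ʳ-cancel : ∀ x y z → cell (x + z) ≡ cell (y + z) → cell x ≡ cell y
  cell-+ʳ-cancel x y zero    eq rewrite +-identityʳ x | +-identityʳ y = eq
  cell-+ʳ-cancel x y (suc z) eq rewrite +-suc x z | +-suc y z = cell-+ʳ-cancel x y z (next-injective eq)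

  cell-+t : ∀ x → cell (x + t) ≡ cell x
  cell-+t x = trans (cong cell (+-comm x t)) (cell-+ʳ t 0 x cell-t)

  cell≢cell-+ : ∀ x {y} → 0 < y → y < t → cell x ≢ cell (x + y)
  cell≢cell-+ x {y} 0<y y<t eq = <-irrefl 0≡y 0<y
    where
    cell0≡celly : cell 0 ≡ cell y
    cell0≡celly = cell-+ʳ-cancel 0 y x (trans eq (cong cell (+-comm x y)))
    0≡y : 0 ≡ y
    0≡y = trans (sym (toℕ-cell z<s)) (trans (cong toℕ cell0≡celly) (toℕ-cell y<t))

  window-all : ∀ {ℓ} (P : Fin t → Set ℓ) a → (∀ i → i < t → P (cell (a + i))) → ∀ z → P (cell (a + z))
  window-all P a all-window = <-rec _ go
    where
    go : ∀ z → (∀ {y} → y < z → P (cell (a + y))) → P (cell (a + z))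
    go z rec with z <? t
    ... | yes z<t = all-window z z<t
    ... | no  z≮t with y , refl ← m≤n⇒∃[o]m+o≡n (≮⇒≥ z≮t) =
      subst P (sym (trans (cong cell (trans (cong (a +_) (+-comm t y)) (sym (+-assoc a y t)))) (cell-+t (a + y))))
              (rec (m<n+m y z<s))

  hits-in-window≤1 : ∀ (c : Fin t) a m → m ≤ t → segSum (λ i → 𝟙 (c ≟ cell i)) a m ≤ 1
  hits-in-window≤1 c a zero    _     = z≤n
  hits-in-window≤1 c a (suc m) m+1≤t with c ≟ cell a
  ... | yes c≡a = ≤-reflexive (cong suc (segSum-zero (suc a) m no-later-hit))
    where
    no-later-hit : ∀ i → i < m → 𝟙 (c ≟ cell (suc a + i)) ≡ 0
    no-later-hit i i<m = 𝟙-no (c ≟ cell (suc a + i)) λ c≡ →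
      cell≢cell-+ a z<s (s<s (≤-trans i<m (≤-pred m+1≤t)))
        (trans (sym c≡a) (trans c≡ (cong cell (sym (+-suc a i)))))
  ... | no _ = hits-in-window≤1 c (suc a) m (<⇒≤ m+1≤t)

private
  none-below-suc : ∀ {p} {P : ℕ → Set p} {n} → (∀ i → i < n → ¬ P i) → ¬ P n → ∀ i → i < suc n → ¬ P i
  none-below-suc {n = n} none ¬Pn i i<n+1 with m≤n⇒m<n∨m≡n (≤-pred i<n+1)
  ... | inj₁ i<n  = none i i<n
  ... | inj₂ refl = ¬Pn

search-least : ∀ {p} {P : ℕ → Set p} → Decidable P → ∀ n →
               (∃ λ r → r < n × P r × (∀ i → i < r → ¬ P i)) ⊎ (∀ i → i < n → ¬ P i)
search-least P? zero = inj₂ (λ i ())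
search-least P? (suc n) with search-least P? n
... | inj₁ (r , r<n , Pr , least) = inj₁ (r , m≤n⇒m≤1+n r<n , Pr , least)
... | inj₂ none with P? n
...   | yes Pn = inj₁ (n , ≤-refl , Pn , none)
...   | no ¬Pn = inj₂ (none-below-suc none ¬Pn)

search-greatest : ∀ {p} {P : ℕ → Set p} → Decidable P → ∀ n →
                  (∃ λ r → r < n × P r × (∀ i → r < i → i < n → ¬ P i)) ⊎ (∀ i → i < n → ¬ P i)
search-greatest P? zero = inj₂ (λ i ())
search-greatest {P = P} P? (suc n) with P? n
... | yes Pn = inj₁ (n , ≤-refl , Pn , λ i n<i i<n+1 → contradiction (<-≤-trans n<i (≤-pred i<n+1)) (<-irrefl refl))
... | no ¬Pn with search-greatest P? n
...   | inj₁ (r , r<n , Pr , greatest) =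
        inj₁ (r , m≤n⇒m≤1+n r<n , Pr , above)
  where
  above : ∀ i → r < i → i < suc n → ¬ P i
  above i r<i i<n+1 with m≤n⇒m<n∨m≡n (≤-pred i<n+1)
  ... | inj₁ i<n  = greatest i r<i i<n
  ... | inj₂ refl = ¬Pn
...   | inj₂ none = inj₂ (none-below-suc none ¬Pn)

Occupied : ∀ {a} {A : Set a} → Maybe A → Set a
Occupied m = ¬ (m ≡ nothing)

empty? : ∀ {a} {A : Set a} (m : Maybe A) → Dec (m ≡ nothing)
empty? nothing  = yes refl
empty? (just _) = no (λ ())

write-same : ∀ {u t} (T : Table u t) c x → write T c x c ≡ just x
write-same T c x with c ≟ c
... | yes _   = refl
... | no  c≢c = contradiction refl c≢c

write-other : ∀ {u t} (T : Table u t) c x {c′} → c′ ≢ c → write T c x c′ ≡ T c′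
write-other T c x {c′} c′≢c with c′ ≟ c
... | yes c′≡c = contradiction c′≡c c′≢c
... | no  _    = refl

module Probing (t′ : ℕ) {u : ℕ} (h : HashFn u (suc t′)) where
  open Cells t′

  hits : Fin u → ℕ → ℕ → ℕ
  hits x a m = segSum (λ i → 𝟙 (h x ≟ cell i)) a m

  load : List (Fin u) → ℕ → ℕ → ℕ
  load keys a m = segSum (λ i → ∑ keys (λ x → 𝟙 (h x ≟ cell i))) a m

  load≡∑hits : ∀ keys a m → load keys a m ≡ ∑ keys (λ x → hits x a m)
  load≡∑hits keys a m = segSum-∑ keys (λ i x → 𝟙 (h x ≟ cell i)) a m

  load≤length : ∀ keys a m → m ≤ t → load keys a m ≤ length keys
  load≤length keys a m m≤t = begin
    load keys a m               ≡⟨ load≡∑hits keys a m ⟩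
    ∑ keys (λ x → hits x a m)   ≤⟨ ∑-mono keys (λ x → hits-in-window≤1 (h x) a m m≤t) ⟩
    ∑ keys (λ _ → 1)            ≡⟨ ∑-const keys 1 ⟩
    length keys * 1             ≡⟨ *-identityʳ _ ⟩
    length keys                 ∎
    where open ≤-Reasoning

  load-∷ʳ : ∀ keys x a m → load (keys ∷ʳ x) a m ≡ load keys a m + hits x a m
  load-∷ʳ keys x a m = begin
    load (keys ∷ʳ x) a m
      ≡⟨ segSum-cong a m (λ i → trans (∑-++ keys [ x ] _) (cong (∑ keys _ +_) (+-identityʳ _))) ⟩
    segSum (λ i → ∑ keys (λ y → 𝟙 (h y ≟ cell i)) + 𝟙 (h x ≟ cell i)) a m
      ≡⟨ segSum-distrib-+ _ _ a m ⟩
    load keys a m + hits x a m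
      ∎
    where open ≡-Reasoning

  load-mono-∷ʳ : ∀ keys x a m → load keys a m ≤ load (keys ∷ʳ x) a m
  load-mono-∷ʳ keys x a m rewrite load-∷ʳ keys x a m = m≤m+n _ _

  -- Every key stored in a run of occupied cells hashes into that run, since
  -- probing never passes an empty cell; so a run following an empty cell has
  -- at least as many keys hashing into it as it has cells.
  RunBound : Table u t → List (Fin u) → Set
  RunBound T keys = ∀ a m → T (cell a) ≡ nothing → (∀ i → i < m → Occupied (T (cell (suc a + i)))) →
                    m ≤ load keys (suc a) m

  FullBound : Table u t → List (Fin u) → Set
  FullBound T keys = ∀ a → (∀ i → i < t → Occupied (T (cell (a + i)))) → t ≤ length keys

  Invariant : Table u t → List (Fin u) → Set
  Invariant T keys = RunBound T keys × FullBound T keys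

  invariant-cong : ∀ {T T′ keys} → (∀ c → T′ c ≡ T c) → Invariant T keys → Invariant T′ keys
  invariant-cong T′≗T (runs , full) =
    (λ a m empty occ → runs a m (trans (sym (T′≗T _)) empty) (λ i i<m → occ i i<m ∘ trans (T′≗T _))) ,
    (λ a occ → full a (λ i i<t → occ i i<t ∘ trans (T′≗T _)))

  invariant-empty : Invariant emptyTable []
  invariant-empty = (λ { a zero _ _ → z≤n ; a (suc m) _ occ → contradiction refl (occ 0 z<s) }) ,
                    (λ a occ → contradiction refl (occ 0 z<s))

  -- The first alternative occurs when the whole table is occupied.
  Placement : Table u t → ℕ → Fin u → Table u t → Set
  Placement T a x T′ = (∀ c → T′ c ≡ T c) ⊎
    (∃ λ j → (∀ i → i < j → Occupied (T (cell (a + i)))) × T (cell (a + j)) ≡ nothing ×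
             (∀ c → T′ c ≡ write T (cell (a + j)) x c))

  placement : ∀ T a fuel x → Placement T a x (place T (cell a) fuel x)
  placement T a zero       x = inj₁ (λ c → refl)
  placement T a (suc fuel) x with T (cell a) in eq
  ... | nothing = inj₂ (0 , (λ i ()) , subst (λ k → T (cell k) ≡ nothing) (sym (+-identityʳ a)) eq ,
                        λ c → cong (λ k → write T (cell k) x c) (sym (+-identityʳ a)))
  ... | just _ with placement T (suc a) fuel x
  ...   | inj₁ unchanged = inj₁ unchanged
  ...   | inj₂ (j , occ , empty , written) =
          inj₂ (suc j , occ′ , subst (λ k → T (cell k) ≡ nothing) (sym (+-suc a j)) empty ,
                λ c → trans (written c) (cong (λ k → write T (cell k) x c) (sym (+-suc a j))))
    where
    occ′ : ∀ i → i < suc j → Occupied (T (cell (a + i)))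
    occ′ zero    _         rewrite +-identityʳ a | eq = λ ()
    occ′ (suc i) (s<s i<j) rewrite +-suc a i = occ i i<j

  module _ (T : Table u t) (keys : List (Fin u)) (x : Fin u) where

    private
      length-∷ʳ : length (keys ∷ʳ x) ≡ suc (length keys)
      length-∷ʳ = trans (length-++ keys) (+-comm (length keys) 1)

    invariant-weaken-∷ʳ : Invariant T keys → Invariant T (keys ∷ʳ x)
    invariant-weaken-∷ʳ (runs , full) =
      (λ a m empty occ → ≤-trans (runs a m empty occ) (load-mono-∷ʳ keys x (suc a) m)) ,
      (λ a occ → ≤-trans (full a occ) (≤-trans (n≤1+n _) (≤-reflexive (sym length-∷ʳ))))

    module Written (a₀ j : ℕ) (a₀≡hx : cell a₀ ≡ h x)
                   (probed : ∀ i → i < j → Occupied (T (cell (a₀ + i))))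
                   (d-empty : T (cell (a₀ + j)) ≡ nothing) where

      d : Fin t
      d = cell (a₀ + j)

      T′ : Table u t
      T′ = write T d x

      empty-before-write : ∀ {c} → T′ c ≡ nothing → T c ≡ nothing × c ≢ d
      empty-before-write {c} empty = by-cases (c ≟ d)
        where
        by-cases : Dec (c ≡ d) → T c ≡ nothing × c ≢ d
        by-cases (yes refl) = contradiction (trans (sym (write-same T d x)) empty) (λ ())
        by-cases (no c≢d)   = trans (sym (write-other T d x c≢d)) empty , c≢d

      occupied-before-write : ∀ {c} → Occupied (T′ c) → c ≢ d → Occupied (T c)
      occupied-before-write occ c≢d empty = occ (trans (write-other T d x c≢d) empty)

      -- The probe sequence of x cannot cross the empty cell a, so h x lies in the
      -- part of the run after a that precedes d.
      hash-in-run : ∀ a r → T (cell a) ≡ nothing → cell (suc a + r) ≡ d → ∃ λ i → i ≤ r × h x ≡ cell (suc a + i)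
      hash-in-run a r empty d≡ with j ≤? r
      ... | yes j≤r with i , refl ← m≤n⇒∃[o]m+o≡n j≤r =
        i , m≤n+m i j , trans (sym a₀≡hx) (cell-+ʳ-cancel a₀ (suc a + i) j
                                             (trans (sym d≡) (cong cell (rearrange a j i))))
        where
        rearrange : ∀ a j i → suc a + (j + i) ≡ suc a + i + j
        rearrange = solve-∀
      ... | no j≰r with i , refl ← m≤n⇒∃[o]m+o≡n (≰⇒> j≰r) =
        ⊥-elim (probed i (s≤s (m≤n+m i r)) (subst (λ c → T c ≡ nothing) (sym a≡a₀+i) empty))
        where
        rearrange : ∀ a₀ r i → a₀ + (suc r + i) ≡ a₀ + i + suc r
        rearrange = solve-∀
        a≡a₀+i : cell (a₀ + i) ≡ cell a
        a≡a₀+i = cell-+ʳ-cancel (a₀ + i) a (suc r)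
                   (trans (cong cell (sym (rearrange a₀ r i))) (trans (sym d≡) (cong cell (sym (+-suc a r)))))

      -- A run after an empty cell a that contains d = cell (suc a + r): both pieces
      -- beside d were runs of T, and x itself hashes into the run.
      run-through-d : RunBound T keys → ∀ a r m →
        T′ (cell a) ≡ nothing → (∀ i → i < suc r + m → Occupied (T′ (cell (suc a + i)))) →
        cell (suc a + r) ≡ d → (∀ i → i < r → cell (suc a + i) ≢ d) →
        suc r + m ≤ load (keys ∷ʳ x) (suc a) (suc r + m)
      run-through-d runs a r m empty′ occ′ d≡ before-d = begin
        suc r + m                                         ≡⟨ +-comm 1 (r + m) ⟩
        r + m + 1                                         ≤⟨ +-mono-≤ (+-mono-≤ left (≤-trans right (m≤n+m _ _))) x-hits ⟩
        load keys (suc a) r + (∑ keys _ + load keys (suc (suc a + r)) m) + hits x (suc a) (suc r + m)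
                                                          ≡⟨ cong (_+ hits x (suc a) (suc r + m)) (segSum-split _ (suc a) r (suc m)) ⟨
        load keys (suc a) (r + suc m) + hits x (suc a) (suc r + m)
                                                          ≡⟨ cong (λ k → load keys (suc a) k + hits x (suc a) (suc r + m)) (+-suc r m) ⟩
        load keys (suc a) (suc r + m) + hits x (suc a) (suc r + m)
                                                          ≡⟨ load-∷ʳ keys x (suc a) (suc r + m) ⟨
        load (keys ∷ʳ x) (suc a) (suc r + m)              ∎
        where
        open ≤-Reasoning
        empty : T (cell a) ≡ nothing
        empty = proj₁ (empty-before-write empty′)

        run<t : suc r + m < t
        run<t with suc r + m <? t
        ... | yes run<t = run<t
        ... | no  run≮t = ⊥-elim (occ′ t′ (≮⇒≥ run≮t)
                 (trans (cong T′ (trans (cong cell (sym (+-suc a t′))) (cell-+t a))) empty′))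

        left : r ≤ load keys (suc a) r
        left = runs a r empty λ i i<r →
          occupied-before-write (occ′ i (<-trans i<r (s≤s (m≤m+n r m)))) (before-d i i<r)

        after-d : ∀ a r i → suc a + (suc r + i) ≡ suc (suc a + r) + i
        after-d = solve-∀

        after-d′ : ∀ a r i → suc a + r + suc i ≡ suc (suc a + r) + i
        after-d′ = solve-∀

        right : m ≤ load keys (suc (suc a + r)) m
        right = runs (suc a + r) m (trans (cong T d≡) d-empty) λ i i<m →
          occupied-before-write
            (subst (λ k → Occupied (T′ (cell k))) (after-d a r i) (occ′ (suc r + i) (+-monoʳ-< (suc r) i<m)))
            (λ d≡′ → cell≢cell-+ (suc a + r) z<s (≤-<-trans (s≤s (m≤n+m i r)) (<-trans (+-monoʳ-< (suc r) i<m) run<t))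
                       (trans d≡ (trans (sym d≡′) (cong cell (sym (after-d′ a r i))))))

        x-hits : 1 ≤ hits x (suc a) (suc r + m)
        x-hits with i , i≤r , hx≡ ← hash-in-run a r empty d≡ =
          ≤-trans (≤-reflexive (sym (𝟙-yes (h x ≟ cell (suc a + i)) hx≡)))
                  (term≤segSum _ (suc a) (suc r + m) i (≤-<-trans i≤r (m≤m+n (suc r) m)))

      runBound-written : RunBound T keys → RunBound T′ (keys ∷ʳ x)
      runBound-written runs a m empty′ occ′ with search-least (λ r → cell (suc a + r) ≟ d) m
      ... | inj₂ d∉run = ≤-trans
        (runs a m (proj₁ (empty-before-write empty′)) λ i i<m → occupied-before-write (occ′ i i<m) (d∉run i i<m))
        (load-mono-∷ʳ keys x (suc a) m)
      ... | inj₁ (r , r<m , d≡ , before-d) with m′ , refl ← m≤n⇒∃[o]m+o≡n r<m =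
        run-through-d runs a r m′ empty′ occ′ d≡ before-d

      -- A full T′ has d at some offset r of the turn from a; the turn continued
      -- from d is a run of T after the empty cell d.
      fullBound-written : Invariant T keys → FullBound T′ (keys ∷ʳ x)
      fullBound-written (runs , full) a occ′ with search-least (λ r → cell (a + r) ≟ d) t
      ... | inj₂ d∉turn = ≤-trans (full a λ i i<t → occupied-before-write (occ′ i i<t) (d∉turn i i<t))
                                  (≤-trans (n≤1+n _) (≤-reflexive (sym length-∷ʳ)))
      ... | inj₁ (r , _ , d≡ , _) = subst (t ≤_) (sym length-∷ʳ) (s≤s (≤-trans
              (runs (a + r) t′ (trans (cong T d≡) d-empty) λ i i<t′ →
                 occupied-before-write (subst (λ k → Occupied (T′ (cell k))) (after-d a r i) (occ-everywhere (r + suc i)))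
                   (λ d≡′ → cell≢cell-+ (a + r) z<s (s≤s i<t′)
                              (trans d≡ (trans (sym d≡′) (cong cell (sym (after-d′ a r i)))))))
              (load≤length keys _ t′ (n≤1+n t′))))
        where
        occ-everywhere = window-all (λ c → Occupied (T′ c)) a occ′
        after-d : ∀ a r i → a + (r + suc i) ≡ suc (a + r) + i
        after-d = solve-∀
        after-d′ : ∀ a r i → a + r + suc i ≡ suc (a + r) + i
        after-d′ = solve-∀

    insert-preserves : Invariant T keys → Invariant (insert h T x) (keys ∷ʳ x)
    insert-preserves inv
      with subst (λ c → Placement T (toℕ (h x)) x (place T c t x)) (cell-toℕ (h x)) (placement T (toℕ (h x)) t x)
    ... | inj₁ unchanged = invariant-cong {keys = keys ∷ʳ x} unchanged (invariant-weaken-∷ʳ inv)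
    ... | inj₂ (j , probed , empty , written) = invariant-cong {keys = keys ∷ʳ x} written
          (runBound-written (proj₁ inv) , fullBound-written inv)
      where open Written (toℕ (h x)) j (cell-toℕ (h x)) probed empty

  foldl-insert-invariant : ∀ T keys ks → Invariant T keys → Invariant (foldl (insert h) T ks) (keys ++ ks)
  foldl-insert-invariant T keys []       inv = subst (Invariant T) (sym (++-identityʳ keys)) inv
  foldl-insert-invariant T keys (k ∷ ks) inv =
    subst (Invariant (foldl (insert h) (insert h T k) ks)) (++-assoc keys [ k ] ks)
          (foldl-insert-invariant (insert h T k) (keys ∷ʳ k) ks (insert-preserves T keys k inv))

  build-invariant : ∀ keys → Invariant (build h keys) keys
  build-invariant keys = foldl-insert-invariant emptyTable [] keys invariant-empty

scanTime≤fuel : ∀ {u t} (T : Table u t) c fuel → scanTime T c fuel ≤ fuel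
scanTime≤fuel T c zero       = z≤n
scanTime≤fuel T c (suc fuel) with T c
... | nothing = s≤s z≤n
... | just _  = s≤s (scanTime≤fuel T (next c) fuel)

module _ (t′ : ℕ) {u : ℕ} where
  open Cells t′

  scan-occupied : ∀ (T : Table u t) a fuel ℓ → ℓ < scanTime T (cell a) fuel →
                  ∀ i → i < ℓ → Occupied (T (cell (a + i)))
  scan-occupied T a (suc fuel) ℓ ℓ<scan i i<ℓ with T (cell a) in eq
  scan-occupied T a (suc fuel) (suc ℓ) (s<s ()) i i<ℓ | nothing
  scan-occupied T a (suc fuel) ℓ ℓ<scan zero i<ℓ | just _ rewrite +-identityʳ a | eq = λ ()
  scan-occupied T a (suc fuel) (suc ℓ) (s<s ℓ<scan) (suc i) (s<s i<ℓ) | just _ rewrite +-suc a i =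
    scan-occupied T (suc a) fuel ℓ ℓ<scan i i<ℓ

  -- If a search from cell a passes ℓ occupied cells, then the last empty cell
  -- before a starts a run of m ≥ ℓ cells, which (by RunBound) is overloaded.
  long-scan⇒overloaded-segment : ∀ (h : HashFn u t) (T : Table u t) keys → Probing.Invariant t′ h T keys →
    length keys < t → ∀ a ℓ → ℓ < scanTime T (cell a) t →
    ∃₂ λ s m → ℓ ≤ m × s ≤ a + t × m ≤ t + ℓ × m ≤ Probing.load t′ h keys s m
  long-scan⇒overloaded-segment h T keys (runs , full) keys<t a ℓ ℓ<scan
    with search-greatest (λ i → empty? (T (cell (a + i)))) t
  ... | inj₂ no-empty = ⊥-elim (<-irrefl refl (<-≤-trans keys<t (full a no-empty)))
  ... | inj₁ (i , i<t , empty , last-empty) with k , i+1+k≡t ← m≤n⇒∃[o]m+o≡n i<t =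
    suc (a + i) , k + ℓ , m≤n+m ℓ k , ≤-trans (≤-reflexive (sym (+-suc a i))) (+-monoʳ-≤ a i<t) ,
    +-monoˡ-≤ ℓ (≤-trans (m≤n+m k (suc i)) (≤-reflexive i+1+k≡t)) ,
    runs (a + i) (k + ℓ) empty occupied
    where
    before-wrap : ∀ a i z → suc (a + i) + z ≡ a + (suc i + z)
    before-wrap = solve-∀
    after-wrap : ∀ a i k z → suc (a + i) + (k + z) ≡ (a + z) + (suc i + k)
    after-wrap = solve-∀

    occupied : ∀ z → z < k + ℓ → Occupied (T (cell (suc (a + i) + z)))
    occupied z z<k+ℓ with z <? k
    ... | yes z<k = subst (λ w → Occupied (T (cell w))) (sym (before-wrap a i z))
                      (last-empty (suc i + z) (s≤s (m≤m+n i z)) (≤-trans (+-monoʳ-< (suc i) z<k) (≤-reflexive i+1+k≡t)))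
    ... | no  z≮k with z′ , refl ← m≤n⇒∃[o]m+o≡n (≮⇒≥ z≮k) =
      subst (λ c → Occupied (T c))
            (sym (trans (cong cell (trans (after-wrap a i k z′) (cong ((a + z′) +_) i+1+k≡t))) (cell-+t (a + z′))))
            (scan-occupied T a t ℓ ℓ<scan z′ (+-cancelˡ-< k z′ ℓ z<k+ℓ))

segSum-blocks : ∀ f b k N → segSum f (k * b) (N * b) ≡ segSum (λ k → segSum f (k * b) b) k N
segSum-blocks f b k zero    = refl
segSum-blocks f b k (suc N) rewrite segSum-split f (k * b) b (N * b) | +-comm (k * b) b =
  cong (segSum f (k * b) b +_) (segSum-blocks f b (suc k) N)

<[m/n]*n+n : ∀ m n .{{_ : NonZero n}} → m < (m / n) * n + n
<[m/n]*n+n m n = begin-strict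
  m                     ≡⟨ m≡m%n+[m/n]*n m n ⟩
  m % n + (m / n) * n   <⟨ +-monoˡ-< ((m / n) * n) (m%n<n m n) ⟩
  n + (m / n) * n       ≡⟨ +-comm n _ ⟩
  (m / n) * n + n       ∎
  where open ≤-Reasoning

-- The N = m / b + 2 aligned blocks of length b from block s / b on cover
-- [s, s + m); if each carried at most 7b/8, the segment would carry at most
-- 7m/8 + 7b/4, which is less than m as soon as m > 14b.
overloaded-segment⇒overloaded-block : ∀ f b .{{_ : NonZero b}} s m → 15 * b ≤ m → m ≤ segSum f s m →
  ∃ λ k → k < s / b + m / b + 2 × 7 * b < 8 * segSum f (k * b) b
overloaded-segment⇒overloaded-block f b s m 15b≤m m≤load
  with search-least (λ j → 7 * b <? 8 * segSum f ((s / b + j) * b) b) (m / b + 2)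
... | inj₁ (j , j<N , overloaded , _) =
  s / b + j , subst (s / b + j <_) (sym (+-assoc (s / b) (m / b) 2)) (+-monoʳ-< (s / b) j<N) , overloaded
... | inj₂ none = ⊥-elim (<-irrefl refl (<-≤-trans 14b<m m≤14b))
  where
  k₀ = s / b
  N = m / b + 2

  cover : s + m ≤ k₀ * b + N * b
  cover = ≤-trans (<⇒≤ (+-mono-< (<[m/n]*n+n s b) (<[m/n]*n+n m b))) (≤-reflexive (regroup (k₀ * b) (m / b) b))
    where
    regroup : ∀ x y b → x + b + (y * b + b) ≡ x + (y + 2) * b
    regroup = solve-∀

  blocks-light : 8 * segSum f (k₀ * b) (N * b) ≤ N * (7 * b)
  blocks-light = begin
    8 * segSum f (k₀ * b) (N * b)                     ≡⟨ cong (8 *_) (segSum-blocks f b k₀ N) ⟩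
    8 * segSum (λ k → segSum f (k * b) b) k₀ N        ≡⟨ segSum-*ˡ 8 _ k₀ N ⟨
    segSum (λ k → 8 * segSum f (k * b) b) k₀ N        ≤⟨ segSum-≤-const k₀ N (7 * b) (λ j j<N → ≮⇒≥ (none j j<N)) ⟩
    N * (7 * b)                                       ∎
    where open ≤-Reasoning

  8m≤7m+14b : 8 * m ≤ 7 * m + 14 * b
  8m≤7m+14b = begin
    8 * m                               ≤⟨ *-monoʳ-≤ 8 m≤load ⟩
    8 * segSum f s m                    ≤⟨ *-monoʳ-≤ 8 (segSum-sub f (m/n*n≤m s b) cover) ⟩
    8 * segSum f (k₀ * b) (N * b)       ≤⟨ blocks-light ⟩
    N * (7 * b)                         ≡⟨ expand (m / b) b ⟩
    7 * ((m / b) * b) + 14 * b          ≤⟨ +-monoˡ-≤ (14 * b) (*-monoʳ-≤ 7 (m/n*n≤m m b)) ⟩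
    7 * m + 14 * b                      ∎
    where
    open ≤-Reasoning
    expand : ∀ q b → (q + 2) * (7 * b) ≡ 7 * (q * b) + 14 * b
    expand = solve-∀

  m≤14b : m ≤ 14 * b
  m≤14b = +-cancelˡ-≤ (7 * m) _ _ (subst (_≤ 7 * m + 14 * b) (split m) 8m≤7m+14b)
    where
    split : ∀ m → 8 * m ≡ 7 * m + m
    split = solve-∀

  14b<m : 14 * b < m
  14b<m = <-≤-trans (*-monoˡ-< b {14} {15} ≤-refl) 15b≤m

-- With truncated subtraction this is an equality for n ≤ m and strict otherwise.
[m∸n]²+2mn≤m²+n² : ∀ m n → (m ∸ n) * (m ∸ n) + 2 * m * n ≤ m * m + n * n
[m∸n]²+2mn≤m²+n² m n with n ≤? m
... | yes n≤m with e , refl ← m≤n⇒∃[o]m+o≡n n≤m rewrite m+n∸m≡n n e = ≤-reflexive (square n e)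
  where
  square : ∀ n e → e * e + 2 * (n + e) * n ≡ (n + e) * (n + e) + n * n
  square = solve-∀
... | no n≰m with e , refl ← m≤n⇒∃[o]m+o≡n (<⇒≤ (≰⇒> n≰m)) rewrite m≤n⇒m∸n≡0 (m≤m+n m e) =
  ≤-trans (≤-reflexive (expand m e)) (≤-trans (m≤n+m _ (e * e)) (≤-reflexive (regroup m e)))
  where
  expand : ∀ m e → 2 * m * (m + e) ≡ m * m + (m * m + 2 * m * e)
  expand = solve-∀
  regroup : ∀ m e → e * e + (m * m + (m * m + 2 * m * e)) ≡ m * m + (m + e) * (m + e)
  regroup = solve-∀

[2g∸b]²+4gb≤4g²+b² : ∀ g b → (2 * g ∸ b) * (2 * g ∸ b) + 4 * g * b ≤ 4 * (g * g) + b * b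
[2g∸b]²+4gb≤4g²+b² g b =
  subst₂ _≤_ (cong ((2 * g ∸ b) * (2 * g ∸ b) +_) (four g b)) (cong (_+ b * b) (four² g))
         ([m∸n]²+2mn≤m²+n² (2 * g) b)
  where
  four : ∀ g b → 2 * (2 * g) * b ≡ 4 * g * b
  four = solve-∀
  four² : ∀ g → 2 * g * (2 * g) ≡ 4 * (g * g)
  four² = solve-∀

7b<4m⇒9b²≤16[m∸b]² : ∀ m b → 7 * b < 4 * m → 9 * (b * b) ≤ 16 * ((m ∸ b) * (m ∸ b))
7b<4m⇒9b²≤16[m∸b]² m b 7b<4m with b ≤? m
... | yes b≤m with e , refl ← m≤n⇒∃[o]m+o≡n b≤m rewrite m+n∸m≡n b e =
  subst₂ _≤_ (square 3 b) (square 4 e) (*-mono-≤ 3b≤4e 3b≤4e)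
  where
  square : ∀ c x → c * x * (c * x) ≡ c * c * (x * x)
  square = solve-∀
  split-7b : ∀ b → 7 * b ≡ 4 * b + 3 * b
  split-7b = solve-∀
  3b≤4e : 3 * b ≤ 4 * e
  3b≤4e = <⇒≤ (+-cancelˡ-< (4 * b) (3 * b) (4 * e) (subst₂ _<_ (split-7b b) (*-distribˡ-+ 4 b e) 7b<4m))
... | no b≰m = ⊥-elim (<-irrefl refl (<-≤-trans 7b<4m (≤-trans (*-monoʳ-≤ 4 (<⇒≤ (≰⇒> b≰m))) (*-monoˡ-≤ b 4≤7))))
  where
  4≤7 : 4 ≤ 7
  4≤7 = s≤s (s≤s (s≤s (s≤s z≤n)))

7b<8g⇒9b²≤16[2g∸b]² : ∀ g b → 7 * b < 8 * g → 9 * (b * b) ≤ 16 * ((2 * g ∸ b) * (2 * g ∸ b))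
7b<8g⇒9b²≤16[2g∸b]² g b 7b<8g = 7b<4m⇒9b²≤16[m∸b]² (2 * g) b (subst (7 * b <_) (*-assoc 4 2 g) 7b<8g)

-- The hypotheses are E[G] = b/2, t² E[G²] ≤ n(n − 1)b² + ntb at t = 2n, and the
-- pointwise (2G − b)² + 4bG ≤ 4G² + b², each multiplied by the size L of the family.
centred-moment-arith : ∀ n X Y Z b L → 1 ≤ n → 2 * Y ≡ b * L →
  4 * n * Z + b * (b * L) ≤ n * (b * (b * L)) + 2 * n * (b * L) →
  X + 4 * b * Y ≤ 4 * Z + b * (b * L) → X ≤ 2 * b * L
centred-moment-arith n@(suc _) X Y Z b L _ 2Y≡bL second pointwise =
  *-cancelˡ-≤ n (≤-trans (m≤m+n (n * X) A) (+-cancelʳ-≤ (2 * n * A) _ _ chain))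
  where
  A = b * (b * L)
  open ≤-Reasoning
  mean-term : n * (X + 4 * b * Y) ≡ n * X + 2 * n * A
  mean-term = begin-equality
    n * (X + 4 * b * Y)          ≡⟨ expand n X b Y ⟩
    n * X + 2 * n * b * (2 * Y)  ≡⟨ cong (λ y → n * X + 2 * n * b * y) 2Y≡bL ⟩
    n * X + 2 * n * b * (b * L)  ≡⟨ collect n X b L ⟩
    n * X + 2 * n * A            ∎
    where
    expand : ∀ n X b Y → n * (X + 4 * b * Y) ≡ n * X + 2 * n * b * (2 * Y)
    expand = solve-∀
    collect : ∀ n X b L → n * X + 2 * n * b * (b * L) ≡ n * X + 2 * n * (b * (b * L))
    collect = solve-∀
  chain : n * X + A + 2 * n * A ≤ n * (2 * b * L) + 2 * n * A
  chain = begin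
    n * X + A + 2 * n * A              ≡⟨ swap (n * X) A (2 * n * A) ⟩
    n * X + 2 * n * A + A              ≡⟨ cong (_+ A) mean-term ⟨
    n * (X + 4 * b * Y) + A            ≤⟨ +-monoˡ-≤ A (*-monoʳ-≤ n pointwise) ⟩
    n * (4 * Z + A) + A                ≡⟨ regroup n Z A ⟩
    4 * n * Z + A + n * A              ≤⟨ +-monoˡ-≤ (n * A) second ⟩
    n * A + 2 * n * (b * L) + n * A    ≡⟨ regroup′ n A b L ⟩
    n * (2 * b * L) + 2 * n * A        ∎
    where
    swap : ∀ x y z → x + y + z ≡ x + z + y
    swap = solve-∀
    regroup : ∀ n Z A → n * (4 * Z + A) + A ≡ 4 * n * Z + A + n * A
    regroup = solve-∀
    regroup′ : ∀ n A b L → n * A + 2 * n * (b * L) + n * A ≡ n * (2 * b * L) + 2 * n * A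
    regroup′ = solve-∀

∑-unique-≤ : ∀ {a} {A : Set a} (ys : List A) {x} (F : A → ℕ) (P B : ℕ) → Unique ys → x ∈ ys →
  (∀ y → y ≢ x → F y ≤ P) → F x ≤ B → ∑ ys F + P ≤ length ys * P + B
∑-unique-≤ (y ∷ ys) F P B (y∉ys ∷ _) (here refl) off diag = begin
  F y + ∑ ys F + P          ≡⟨ +-assoc (F y) _ P ⟩
  F y + (∑ ys F + P)        ≤⟨ +-mono-≤ diag (+-monoˡ-≤ P (∑-All-≤ ys (All.map (λ y′≢y → off _ (y′≢y ∘ sym)) y∉ys))) ⟩
  B + (length ys * P + P)   ≡⟨ rearrange B (length ys * P) P ⟩
  P + length ys * P + B     ∎
  where
  open ≤-Reasoning
  rearrange : ∀ B q P → B + (q + P) ≡ P + q + B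
  rearrange = solve-∀
∑-unique-≤ (y ∷ ys) F P B (y∉ys ∷ uniq) (there x∈ys) off diag = begin
  F y + ∑ ys F + P          ≡⟨ +-assoc (F y) _ P ⟩
  F y + (∑ ys F + P)        ≤⟨ +-mono-≤ (off y (All.lookup y∉ys x∈ys)) (∑-unique-≤ ys F P B uniq x∈ys off diag) ⟩
  P + (length ys * P + B)   ≡⟨ +-assoc P _ B ⟨
  P + length ys * P + B     ∎
  where open ≤-Reasoning

module BlockMoments (t′ : ℕ) {u : ℕ} (H : Family u (suc t′)) (indep : TwoIndependent H)
                    (keys : List (Fin u)) (unique : Unique keys) (a b : ℕ) (b≤t : b ≤ suc t′) where
  open Cells t′

  L : ℕ
  L = length H

  hitsBlock : HashFn u t → Fin u → ℕ
  hitsBlock h x = Probing.hits t′ h x a b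

  blockLoad : HashFn u t → ℕ
  blockLoad h = Probing.load t′ h keys a b

  blockLoad≡∑hits : ∀ h → blockLoad h ≡ ∑ keys (hitsBlock h)
  blockLoad≡∑hits h = Probing.load≡∑hits t′ h keys a b

  uniform : ∀ x c → t * ∑ H (λ h → 𝟙 (h x ≟ c)) ≡ L
  uniform x c = begin
    t * ∑ H (λ h → 𝟙 (h x ≟ c))                    ≡⟨ cong (t *_) (length-filter≡∑𝟙 (λ h → h x ≟ c) H) ⟨
    t * count₁ H x c                               ≡⟨ *-comm t _ ⟩
    count₁ H x c * t                               ≡⟨ proj₁ indep x c ⟩
    L                                              ∎
    where open ≡-Reasoning

  pairwise-uniform : ∀ x y → x ≢ y → ∀ c c′ → t * t * ∑ H (λ h → 𝟙 ((h x ≟ c) ×-dec (h y ≟ c′))) ≡ L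
  pairwise-uniform x y x≢y c c′ = begin
    t * t * ∑ H (λ h → 𝟙 ((h x ≟ c) ×-dec (h y ≟ c′)))
      ≡⟨ cong (t * t *_) (length-filter≡∑𝟙 (λ h → (h x ≟ c) ×-dec (h y ≟ c′)) H) ⟨
    t * t * count₂ H x y c c′                      ≡⟨ *-comm (t * t) _ ⟩
    count₂ H x y c c′ * (t * t)                    ≡⟨ proj₂ indep x y x≢y c c′ ⟩
    L                                              ∎
    where open ≡-Reasoning

  expected-hits : ∀ x → t * ∑ H (λ h → hitsBlock h x) ≡ b * L
  expected-hits x = begin
    t * ∑ H (λ h → hitsBlock h x)                              ≡⟨ cong (t *_) (segSum-∑ H (λ i h → 𝟙 (h x ≟ cell i)) a b) ⟨
    t * segSum (λ i → ∑ H (λ h → 𝟙 (h x ≟ cell i))) a b        ≡⟨ *-segSum-const t _ a b L (λ i → uniform x (cell i)) ⟩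
    b * L                                                      ∎
    where open ≡-Reasoning

  expected-load : t * ∑ H blockLoad ≡ length keys * (b * L)
  expected-load = begin
    t * ∑ H blockLoad                                  ≡⟨ cong (t *_) (∑-cong H blockLoad≡∑hits) ⟩
    t * ∑ H (λ h → ∑ keys (hitsBlock h))               ≡⟨ cong (t *_) (∑-comm H keys hitsBlock) ⟩
    t * ∑ keys (λ x → ∑ H (λ h → hitsBlock h x))       ≡⟨ ∑-*ˡ keys t _ ⟨
    ∑ keys (λ x → t * ∑ H (λ h → hitsBlock h x))       ≡⟨ ∑-cong keys expected-hits ⟩
    ∑ keys (λ _ → b * L)                               ≡⟨ ∑-const keys (b * L) ⟩
    length keys * (b * L)                              ∎
    where open ≡-Reasoning

  coHits : Fin u → Fin u → ℕ
  coHits x y = ∑ H (λ h → hitsBlock h x * hitsBlock h y)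

  hits*hits : ∀ h x y → hitsBlock h x * hitsBlock h y ≡
              segSum (λ i → segSum (λ j → 𝟙 ((h x ≟ cell i) ×-dec (h y ≟ cell j))) a b) a b
  hits*hits h x y = begin
    hitsBlock h x * hitsBlock h y
      ≡⟨ segSum-*ʳ (hitsBlock h y) _ a b ⟨
    segSum (λ i → 𝟙 (h x ≟ cell i) * hitsBlock h y) a b
      ≡⟨ segSum-cong a b (λ i → segSum-*ˡ (𝟙 (h x ≟ cell i)) _ a b) ⟨
    segSum (λ i → segSum (λ j → 𝟙 (h x ≟ cell i) * 𝟙 (h y ≟ cell j)) a b) a b
      ≡⟨ segSum-cong a b (λ i → segSum-cong a b (λ j → 𝟙-×-dec (h x ≟ cell i) (h y ≟ cell j))) ⟨
    segSum (λ i → segSum (λ j → 𝟙 ((h x ≟ cell i) ×-dec (h y ≟ cell j))) a b) a b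
      ∎
    where open ≡-Reasoning

  coHits-distinct : ∀ x y → x ≢ y → t * t * coHits x y ≡ b * (b * L)
  coHits-distinct x y x≢y = begin
    t * t * coHits x y
      ≡⟨ cong (t * t *_) (∑-cong H (λ h → hits*hits h x y)) ⟩
    t * t * ∑ H (λ h → segSum (λ i → segSum (λ j → 𝟙x×y h i j) a b) a b)
      ≡⟨ cong (t * t *_) (segSum-∑ H (λ i h → segSum (λ j → 𝟙x×y h i j) a b) a b) ⟨
    t * t * segSum (λ i → ∑ H (λ h → segSum (λ j → 𝟙x×y h i j) a b)) a b
      ≡⟨ *-segSum-const (t * t) _ a b (b * L) row ⟩
    b * (b * L)
      ∎
    where
    open ≡-Reasoning
    𝟙x×y : HashFn u t → ℕ → ℕ → ℕ
    𝟙x×y h i j = 𝟙 ((h x ≟ cell i) ×-dec (h y ≟ cell j))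
    row : ∀ i → t * t * ∑ H (λ h → segSum (λ j → 𝟙x×y h i j) a b) ≡ b * L
    row i = begin
      t * t * ∑ H (λ h → segSum (λ j → 𝟙x×y h i j) a b)
        ≡⟨ cong (t * t *_) (segSum-∑ H (λ j h → 𝟙x×y h i j) a b) ⟨
      t * t * segSum (λ j → ∑ H (λ h → 𝟙x×y h i j)) a b
        ≡⟨ *-segSum-const (t * t) _ a b L (λ j → pairwise-uniform x y x≢y (cell i) (cell j)) ⟩
      b * L
        ∎

  coHits-same : ∀ x → t * t * coHits x x ≤ t * (b * L)
  coHits-same x = begin
    t * t * coHits x x                          ≡⟨ *-assoc t t _ ⟩
    t * (t * coHits x x)                        ≤⟨ *-monoʳ-≤ t (*-monoʳ-≤ t (∑-mono H λ h → *-monoʳ-≤ (hitsBlock h x) (≤1 h))) ⟩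
    t * (t * ∑ H (λ h → hitsBlock h x * 1))     ≡⟨ cong (λ s → t * (t * s)) (∑-cong H (λ h → *-identityʳ _)) ⟩
    t * (t * ∑ H (λ h → hitsBlock h x))         ≡⟨ cong (t *_) (expected-hits x) ⟩
    t * (b * L)                                 ∎
    where
    open ≤-Reasoning
    ≤1 : ∀ h → hitsBlock h x ≤ 1
    ≤1 h = hits-in-window≤1 (h x) a b b≤t

  ∑load²≡∑coHits : ∑ H (λ h → blockLoad h * blockLoad h) ≡ ∑ keys (λ x → ∑ keys (coHits x))
  ∑load²≡∑coHits = begin
    ∑ H (λ h → blockLoad h * blockLoad h)
      ≡⟨ ∑-cong H (λ h → trans (cong₂ _*_ (blockLoad≡∑hits h) (blockLoad≡∑hits h)) (square h)) ⟩
    ∑ H (λ h → ∑ keys (λ x → ∑ keys (λ y → hitsBlock h x * hitsBlock h y)))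
      ≡⟨ ∑-comm H keys _ ⟩
    ∑ keys (λ x → ∑ H (λ h → ∑ keys (λ y → hitsBlock h x * hitsBlock h y)))
      ≡⟨ ∑-cong keys (λ x → ∑-comm H keys _) ⟩
    ∑ keys (λ x → ∑ keys (coHits x))
      ∎
    where
    open ≡-Reasoning
    square : ∀ h → ∑ keys (hitsBlock h) * ∑ keys (hitsBlock h) ≡
                   ∑ keys (λ x → ∑ keys (λ y → hitsBlock h x * hitsBlock h y))
    square h = begin
      ∑ keys (hitsBlock h) * ∑ keys (hitsBlock h)                 ≡⟨ ∑-*ʳ keys _ (hitsBlock h) ⟨
      ∑ keys (λ x → hitsBlock h x * ∑ keys (hitsBlock h))         ≡⟨ ∑-cong keys (λ x → ∑-*ˡ keys (hitsBlock h x) _) ⟨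
      ∑ keys (λ x → ∑ keys (λ y → hitsBlock h x * hitsBlock h y)) ∎

  second-moment : let k = length keys in
    t * t * ∑ H (λ h → blockLoad h * blockLoad h) + k * (b * (b * L)) ≤ k * (k * (b * (b * L)) + t * (b * L))
  second-moment = begin
    t * t * ∑ H (λ h → blockLoad h * blockLoad h) + k * A
      ≡⟨ cong₂ _+_ (cong (t * t *_) ∑load²≡∑coHits) (sym (∑-const keys A)) ⟩
    t * t * ∑ keys (λ x → ∑ keys (coHits x)) + ∑ keys (λ _ → A)
      ≡⟨ cong (_+ ∑ keys (λ _ → A)) (∑-*ˡ keys (t * t) _) ⟨
    ∑ keys (λ x → t * t * ∑ keys (coHits x)) + ∑ keys (λ _ → A)
      ≡⟨ ∑-distrib-+ keys _ _ ⟨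
    ∑ keys (λ x → t * t * ∑ keys (coHits x) + A)
      ≤⟨ ∑-mono-∈ keys row ⟩
    ∑ keys (λ _ → k * A + B)
      ≡⟨ ∑-const keys _ ⟩
    k * (k * A + B)
      ∎
    where
    open ≤-Reasoning
    k = length keys
    A = b * (b * L)
    B = t * (b * L)
    row : ∀ {x} → x ∈ keys → t * t * ∑ keys (coHits x) + A ≤ k * A + B
    row {x} x∈keys = subst (λ s → s + A ≤ k * A + B) (∑-*ˡ keys (t * t) (coHits x))
      (∑-unique-≤ keys (λ y → t * t * coHits x y) A B unique x∈keys
        (λ y y≢x → ≤-reflexive (coHits-distinct x y (y≢x ∘ sym))) (coHits-same x))

suc≡2*n⇒0<n : ∀ {m} n → suc m ≡ 2 * n → 0 < n
suc≡2*n⇒0<n (suc _) _ = s≤s z≤n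

module HalfFullBlock (n t′ : ℕ) (t≡2n : suc t′ ≡ 2 * n) {u : ℕ} (H : Family u (suc t′)) (indep : TwoIndependent H)
                     (keys : List (Fin u)) (|keys|≡n : length keys ≡ n) (unique : Unique keys)
                     (a b : ℕ) (b≤t : b ≤ suc t′) where
  open Cells t′ using (t)
  open BlockMoments t′ H indep keys unique a b b≤t

  private instance
    n-nonZero : NonZero n
    n-nonZero = >-nonZero (suc≡2*n⇒0<n n t≡2n)

  Z : ℕ
  Z = ∑ H (λ h → blockLoad h * blockLoad h)

  centred : HashFn u (suc t′) → ℕ
  centred h = 2 * blockLoad h ∸ b

  twice-mean : 2 * ∑ H blockLoad ≡ b * L
  twice-mean = *-cancelˡ-≡ _ _ n (begin
    n * (2 * Y)                  ≡⟨ *-comm n (2 * Y) ⟩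
    2 * Y * n                    ≡⟨ *-assoc 2 Y n ⟩
    2 * (Y * n)                  ≡⟨ cong (2 *_) (*-comm Y n) ⟩
    2 * (n * Y)                  ≡⟨ *-assoc 2 n Y ⟨
    2 * n * Y                    ≡⟨ cong (_* Y) t≡2n ⟨
    suc t′ * Y                   ≡⟨ expected-load ⟩
    length keys * (b * L)        ≡⟨ cong (_* (b * L)) |keys|≡n ⟩
    n * (b * L)                  ∎)
    where
    open ≡-Reasoning
    Y = ∑ H blockLoad

  second-moment-half : 4 * n * Z + b * (b * L) ≤ n * (b * (b * L)) + 2 * n * (b * L)
  second-moment-half = *-cancelˡ-≤ n (begin
    n * (4 * n * Z + A)            ≡⟨ regroup n Z A ⟩
    2 * n * (2 * n) * Z + n * A    ≡⟨ cong (λ t → t * t * Z + n * A) t≡2n ⟨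
    t * t * Z + n * A              ≡⟨ cong (λ k → t * t * Z + k * A) |keys|≡n ⟨
    t * t * Z + k * A              ≤⟨ second-moment ⟩
    k * (k * A + t * (b * L))      ≡⟨ cong₂ (λ k t → k * (k * A + t * (b * L))) |keys|≡n t≡2n ⟩
    n * (n * A + 2 * n * (b * L))  ∎)
    where
    open ≤-Reasoning
    k = length keys
    A = b * (b * L)
    regroup : ∀ n Z A → n * (4 * n * Z + A) ≡ 2 * n * (2 * n) * Z + n * A
    regroup = solve-∀

  centred-pointwise : ∑ H (λ h → centred h * centred h) + 4 * b * ∑ H blockLoad ≤ 4 * Z + b * (b * L)
  centred-pointwise = begin
    ∑ H (λ h → centred h * centred h) + 4 * b * ∑ H blockLoad
      ≡⟨ cong (∑ H (λ h → centred h * centred h) +_) (∑-*ˡ H (4 * b) blockLoad) ⟨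
    ∑ H (λ h → centred h * centred h) + ∑ H (λ h → 4 * b * blockLoad h)
      ≡⟨ ∑-distrib-+ H _ _ ⟨
    ∑ H (λ h → centred h * centred h + 4 * b * blockLoad h)
      ≤⟨ ∑-mono H (λ h → subst (λ s → centred h * centred h + s ≤ 4 * (blockLoad h * blockLoad h) + b * b)
                               (xy∙z≈xz∙y 4 (blockLoad h) b) ([2g∸b]²+4gb≤4g²+b² (blockLoad h) b)) ⟩
    ∑ H (λ h → 4 * (blockLoad h * blockLoad h) + b * b)
      ≡⟨ ∑-distrib-+ H _ _ ⟩
    ∑ H (λ h → 4 * (blockLoad h * blockLoad h)) + ∑ H (λ _ → b * b)
      ≡⟨ cong₂ _+_ (∑-*ˡ H 4 _) (trans (∑-const H (b * b)) (trans (*-comm L (b * b)) (*-assoc b b L))) ⟩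
    4 * Z + b * (b * L)
      ∎
    where open ≤-Reasoning

  centred-second-moment : ∑ H (λ h → centred h * centred h) ≤ 2 * b * L
  centred-second-moment = centred-moment-arith n _ _ Z b L (suc≡2*n⇒0<n n t≡2n) twice-mean second-moment-half centred-pointwise

  overloaded : HashFn u (suc t′) → ℕ
  overloaded h = 𝟙 (7 * b <? 8 * blockLoad h)

  overloaded-count : .{{_ : NonZero b}} → b * ∑ H overloaded ≤ 4 * L
  overloaded-count = *-cancelˡ-≤ 9 (begin
    9 * (b * ∑ H overloaded)   ≤⟨ 9b#≤32L ⟩
    32 * L                     ≤⟨ *-monoˡ-≤ L (m≤m+n 32 4) ⟩
    36 * L                     ≡⟨ *-assoc 9 4 L ⟩
    9 * (4 * L)                ∎)
    where
    open ≤-Reasoning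
    far-from-mean : ∀ h → overloaded h * (9 * (b * b)) ≤ 16 * (centred h * centred h)
    far-from-mean h with 7 * b <? 8 * blockLoad h
    ... | yes 7b<8G = subst (_≤ 16 * (centred h * centred h)) (sym (+-identityʳ _)) (7b<8g⇒9b²≤16[2g∸b]² (blockLoad h) b 7b<8G)
    ... | no  _     = z≤n
    #9b²≤32bL : ∑ H overloaded * (9 * (b * b)) ≤ 32 * L * b
    #9b²≤32bL = begin
      ∑ H overloaded * (9 * (b * b))             ≡⟨ ∑-*ʳ H _ overloaded ⟨
      ∑ H (λ h → overloaded h * (9 * (b * b)))   ≤⟨ ∑-mono H far-from-mean ⟩
      ∑ H (λ h → 16 * (centred h * centred h))   ≡⟨ ∑-*ˡ H 16 _ ⟩
      16 * ∑ H (λ h → centred h * centred h)     ≤⟨ *-monoʳ-≤ 16 centred-second-moment ⟩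
      16 * (2 * b * L)                           ≡⟨ regroup b L ⟩
      32 * L * b                                 ∎
      where
      regroup : ∀ b L → 16 * (2 * b * L) ≡ 32 * L * b
      regroup = solve-∀
    9b#≤32L : 9 * (b * ∑ H overloaded) ≤ 32 * L
    9b#≤32L = *-cancelʳ-≤ _ _ b (subst (_≤ 32 * L * b) (regroup (∑ H overloaded) b) #9b²≤32bL)
      where
      regroup : ∀ k b → k * (9 * (b * b)) ≡ 9 * (b * k) * b
      regroup = solve-∀

m<o∸n⇒n+m<o : ∀ m n o → m < o ∸ n → n + m < o
m<o∸n⇒n+m<o m zero    o       m<o   = m<o
m<o∸n⇒n+m<o m (suc n) (suc o) m<o∸n = s≤s (m<o∸n⇒n+m<o m n o m<o∸n)

-- S = ∑_{ℓ < S} 1, of which the terms below M contribute at most M.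
≤-+-count-above : ∀ S M R → S ≤ M + R → S ≤ M + segSum (λ ℓ → 𝟙 (ℓ <? S)) M R
≤-+-count-above S M zero    S≤M+R = S≤M+R
≤-+-count-above S M (suc R) S≤M+R with M <? S
... | yes M<S = subst (S ≤_) (sym (+-suc M _)) (≤-+-count-above S (suc M) R (subst (S ≤_) (+-suc M R) S≤M+R))
... | no  M≮S = ≤-trans (≮⇒≥ M≮S) (m≤m+n M _)

-- A tail ∑_{ℓ > M} X ℓ with ℓ² X ℓ ≤ A is at most A / M, the discrete
-- analogue of ∑_{ℓ > M} 1/ℓ² ≤ 1/M.
tail-≤ : ∀ R M A (X : ℕ → ℕ) → (∀ i → i < R → (suc M + i) * (suc M + i) * X (suc M + i) ≤ A) →
         M * segSum X (suc M) R ≤ A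
tail-≤ zero    M A X _     rewrite *-zeroʳ M = z≤n
tail-≤ (suc R) M A X bound = *-cancelˡ-≤ (suc M) (begin
  suc M * (M * (X (suc M) + rest))                     ≡⟨ distribute M (X (suc M)) rest ⟩
  suc M * M * X (suc M) + M * (suc M * rest)           ≤⟨ +-mono-≤ (*-monoˡ-≤ (X (suc M)) (*-monoʳ-≤ (suc M) (n≤1+n M))) (*-monoʳ-≤ M ih) ⟩
  suc M * suc M * X (suc M) + M * A                    ≤⟨ +-monoˡ-≤ (M * A) first ⟩
  A + M * A                                            ∎)
  where
  open ≤-Reasoning
  rest = segSum X (suc (suc M)) R
  distribute : ∀ M x s → suc M * (M * (x + s)) ≡ suc M * M * x + M * (suc M * s)
  distribute = solve-∀
  first : suc M * suc M * X (suc M) ≤ A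
  first = subst (λ k → k * k * X k ≤ A) (+-identityʳ (suc M)) (bound 0 z<s)
  ih : suc M * rest ≤ A
  ih = tail-≤ R (suc M) A X λ i i<R → subst (λ k → k * k * X k ≤ A) (cong suc (+-suc M i)) (bound (suc i) (s<s i<R))

⌊√_⌋ : ∀ n → ∃ λ m → m * m ≤ n × n < suc m * suc m
⌊√ zero ⌋ = 0 , z≤n , s≤s z≤n
⌊√ suc n ⌋ with m , m²≤n , n<[m+1]² ← ⌊√ n ⌋ with suc n <? suc m * suc m
... | yes n+1<[m+1]² = m , m≤n⇒m≤1+n m²≤n , n+1<[m+1]²
... | no  n+1≮[m+1]² = suc m , ≤-reflexive [m+1]²≡n+1 , subst (_< suc (suc m) * suc (suc m)) [m+1]²≡n+1 (squares-increase m)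
  where
  [m+1]²≡n+1 : suc m * suc m ≡ suc n
  [m+1]²≡n+1 = ≤-antisym (≮⇒≥ n+1≮[m+1]²) n<[m+1]²
  squares-increase : ∀ m → suc m * suc m < suc (suc m) * suc (suc m)
  squares-increase m = *-mono-< (n<1+n (suc m)) (n<1+n (suc m))

-- With M = m + 15 ≤ 16 m and M + 1 ≤ 17 m one has M (M + 1) ≤ 272 m² ≤ 272 n,
-- so M T ≤ (272 + c) n L, and n ≤ M² turns this into the bound on T².
square-bound : ∀ c m n L T Y → m * m ≤ n → n < suc m * suc m → 1 ≤ n →
  T ≤ L * suc (m + 15) + Y → (m + 15) * Y ≤ c * n * L → T * T ≤ (272 + c) * (272 + c) * n * (L * L)
square-bound c zero    n       L T Y _    n<1 1≤n _ _ = ⊥-elim (<-irrefl refl (<-≤-trans n<1 1≤n))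
square-bound c m@(suc _) n@(suc _) L T Y m²≤n n<[m+1]² _ T≤ MY≤ = *-cancelˡ-≤ n (begin
  n * (T * T)                  ≤⟨ *-monoˡ-≤ (T * T) n≤M² ⟩
  M * M * (T * T)              ≡⟨ square-* M T ⟩
  (M * T) * (M * T)            ≤⟨ *-mono-≤ MT≤ MT≤ ⟩
  (D * n * L) * (D * n * L)    ≡⟨ regroup D n L ⟩
  n * (D * D * n * (L * L))    ∎)
  where
  open ≤-Reasoning
  M = m + 15
  D = 272 + c
  square-* : ∀ a b → a * a * (b * b) ≡ a * b * (a * b)
  square-* = solve-∀
  regroup : ∀ D n L → D * n * L * (D * n * L) ≡ n * (D * D * n * (L * L))
  regroup = solve-∀

  n≤M² : n ≤ M * M
  n≤M² = ≤-trans (<⇒≤ n<[m+1]²) (*-mono-≤ m+1≤M m+1≤M)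
    where
    m+1≤M : suc m ≤ M
    m+1≤M = subst (suc m ≤_) (+-comm 15 m) (s≤s (m≤n+m m 14))

  M[M+1]≤272n : M * suc M ≤ 272 * n
  M[M+1]≤272n = begin
    M * suc M            ≤⟨ *-mono-≤ (+-monoʳ-≤ m (m≤m*n 15 m)) (≤-trans (≤-reflexive (sym (+-suc m 15))) (+-monoʳ-≤ m (m≤m*n 16 m))) ⟩
    16 * m * (17 * m)    ≡⟨ product m ⟩
    272 * (m * m)        ≤⟨ *-monoʳ-≤ 272 m²≤n ⟩
    272 * n              ∎
    where
    product : ∀ m → 16 * m * (17 * m) ≡ 272 * (m * m)
    product = solve-∀

  MT≤ : M * T ≤ D * n * L
  MT≤ = begin
    M * T                          ≤⟨ *-monoʳ-≤ M T≤ ⟩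
    M * (L * suc M + Y)            ≡⟨ distribute M L Y ⟩
    L * (M * suc M) + M * Y        ≤⟨ +-mono-≤ (*-monoʳ-≤ L M[M+1]≤272n) MY≤ ⟩
    L * (272 * n) + c * n * L      ≡⟨ collect L n c ⟩
    D * n * L                      ∎
    where
    distribute : ∀ M L Y → M * (L * suc M + Y) ≡ L * (M * suc M) + M * Y
    distribute = solve-∀
    collect : ∀ L n c → L * (272 * n) + c * n * L ≡ (272 + c) * n * L
    collect = solve-∀

-- Kept abstract so that the type checker never unfolds the literal in 43200 * n.
abstract
  C₁ : ℕ
  C₁ = 43200

  C₁≡43200 : C₁ ≡ 43200
  C₁≡43200 = refl

module SearchTail (n t′ : ℕ) (t≡2n : suc t′ ≡ 2 * n) {u : ℕ} (H : Family u (suc t′)) (indep : TwoIndependent H)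
                  (keys : List (Fin u)) (|keys|≡n : length keys ≡ n) (unique : Unique keys) (q : Fin u) where
  open Cells t′

  L : ℕ
  L = length H

  S : HashFn u t → ℕ
  S h = searchTime h keys q

  exceeding : ℕ → ℕ
  exceeding ℓ = ∑ H (λ h → 𝟙 (ℓ <? S h))

  keys<t : length keys < t
  keys<t = subst₂ _<_ (sym |keys|≡n) (trans (*-comm n 2) (sym t≡2n)) (m<m*n n 2 ≤-refl)
    where instance _ = >-nonZero (suc≡2*n⇒0<n n t≡2n)

  overloaded : ℕ → ℕ → HashFn u t → ℕ
  overloaded b k h = 𝟙 (7 * b <? 8 * Probing.load t′ h keys (k * b) b)

  blockCount : (b : ℕ) → .{{NonZero b}} → ℕ
  blockCount b = 2 * ((2 * t) / b) + 2

  -- Since 15 b ≤ ℓ, an overloaded run of m ≥ ℓ cells spans at least 15 blocks;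
  -- it starts below 2t and is at most 2t long, so the overloaded block found in
  -- it has index below blockCount b.
  long-search⇒overloaded-block : ∀ ℓ b .{{_ : NonZero b}} → 15 * b ≤ ℓ → ℓ < t → ∀ h →
    𝟙 (ℓ <? S h) ≤ segSum (λ k → overloaded b k h) 0 (blockCount b)
  long-search⇒overloaded-block ℓ b 15b≤ℓ ℓ<t h with ℓ <? S h
  ... | no  _  = z≤n
  ... | yes ℓ<S
    with s , m , ℓ≤m , s≤a+t , m≤t+ℓ , overloaded-run
           ← long-scan⇒overloaded-segment t′ h (build h keys) keys (Probing.build-invariant t′ h keys) keys<t (toℕ (h q)) ℓ
               (subst (λ c → ℓ < scanTime (build h keys) c t) (sym (cell-toℕ (h q))) ℓ<S)
    with k , k<bound , overloaded-k
           ← overloaded-segment⇒overloaded-block (λ i → ∑ keys (λ x → 𝟙 (h x ≟ cell i))) b s m (≤-trans 15b≤ℓ ℓ≤m) overloaded-run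
    = ≤-trans (≤-reflexive (sym (𝟙-yes (7 * b <? 8 * Probing.load t′ h keys (k * b) b) overloaded-k)))
              (term≤segSum _ 0 _ k (<-≤-trans k<bound bound≤blockCount))
    where
    double : ∀ x → x + x ≡ 2 * x
    double = solve-∀
    s≤2t : s ≤ 2 * t
    s≤2t = ≤-trans s≤a+t (≤-trans (+-monoˡ-≤ t (<⇒≤ (toℕ<n (h q)))) (≤-reflexive (double t)))
    m≤2t : m ≤ 2 * t
    m≤2t = ≤-trans m≤t+ℓ (≤-trans (+-monoʳ-≤ t (<⇒≤ ℓ<t)) (≤-reflexive (double t)))
    bound≤blockCount : s / b + m / b + 2 ≤ blockCount b
    bound≤blockCount = +-monoˡ-≤ 2 (≤-trans (+-mono-≤ (/-monoˡ-≤ b s≤2t) (/-monoˡ-≤ b m≤2t)) (≤-reflexive (double ((2 * t) / b))))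

  ℓ²*exceeding≤C₁nL : ∀ ℓ → 15 ≤ ℓ → ℓ < t → ℓ * ℓ * exceeding ℓ ≤ C₁ * n * L
  ℓ²*exceeding≤C₁nL ℓ 15≤ℓ ℓ<t = begin
    ℓ * ℓ * exceeding ℓ                 ≤⟨ *-monoˡ-≤ (exceeding ℓ) (*-mono-≤ ℓ≤30b ℓ≤30b) ⟩
    30 * b * (30 * b) * exceeding ℓ     ≡⟨ regroup b (exceeding ℓ) ⟩
    900 * (b * (b * exceeding ℓ))       ≤⟨ *-monoʳ-≤ 900 (*-monoʳ-≤ b b*exceeding≤) ⟩
    900 * (b * (K * (4 * L)))           ≡⟨ regroup′ b K L ⟩
    3600 * (b * K) * L                  ≤⟨ *-monoˡ-≤ L (*-monoʳ-≤ 3600 bK≤6t) ⟩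
    3600 * (6 * t) * L                  ≡⟨ cong (λ x → 3600 * (6 * x) * L) t≡2n ⟩
    3600 * (6 * (2 * n)) * L            ≡⟨ regroup″ n L ⟩
    43200 * n * L                       ≡⟨ cong (λ c → c * n * L) C₁≡43200 ⟨
    C₁ * n * L                          ∎
    where
    open ≤-Reasoning
    b = ℓ / 15
    instance _ = >-nonZero (m≥n⇒m/n>0 15≤ℓ)
    K = blockCount b

    15b≤ℓ : 15 * b ≤ ℓ
    15b≤ℓ = ≤-trans (≤-reflexive (*-comm 15 b)) (m/n*n≤m ℓ 15)

    ℓ≤30b : ℓ ≤ 30 * b
    ℓ≤30b = begin
      ℓ                   ≡⟨ m≡m%n+[m/n]*n ℓ 15 ⟩
      ℓ % 15 + b * 15     ≤⟨ +-monoˡ-≤ (b * 15) (<⇒≤ (m%n<n ℓ 15)) ⟩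
      15 + b * 15         ≤⟨ +-monoˡ-≤ (b * 15) (m≤m*n 15 b) ⟩
      15 * b + b * 15     ≡⟨ double-15 b ⟩
      30 * b              ∎
      where
      double-15 : ∀ b → 15 * b + b * 15 ≡ 30 * b
      double-15 = solve-∀

    b≤t : b ≤ t
    b≤t = ≤-trans (m/n≤m ℓ 15) (<⇒≤ ℓ<t)

    b*exceeding≤ : b * exceeding ℓ ≤ K * (4 * L)
    b*exceeding≤ = begin
      b * exceeding ℓ
        ≤⟨ *-monoʳ-≤ b (∑-mono H (long-search⇒overloaded-block ℓ b 15b≤ℓ ℓ<t)) ⟩
      b * ∑ H (λ h → segSum (λ k → overloaded b k h) 0 K)
        ≡⟨ cong (b *_) (segSum-∑ H (overloaded b) 0 K) ⟨
      b * segSum (λ k → ∑ H (overloaded b k)) 0 K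
        ≡⟨ segSum-*ˡ b _ 0 K ⟨
      segSum (λ k → b * ∑ H (overloaded b k)) 0 K
        ≤⟨ segSum-≤-const 0 K (4 * L) (λ k _ → HalfFullBlock.overloaded-count n t′ t≡2n H indep keys |keys|≡n unique (k * b) b b≤t) ⟩
      K * (4 * L)
        ∎

    bK≤6t : b * K ≤ 6 * t
    bK≤6t = begin
      b * K                               ≡⟨ distribute b ((2 * t) / b) ⟩
      2 * ((2 * t) / b * b) + 2 * b       ≤⟨ +-mono-≤ (*-monoʳ-≤ 2 (m/n*n≤m (2 * t) b)) (*-monoʳ-≤ 2 b≤t) ⟩
      2 * (2 * t) + 2 * t                 ≡⟨ collect t ⟩
      6 * t                               ∎
      where
      distribute : ∀ b Q → b * (2 * Q + 2) ≡ 2 * (Q * b) + 2 * b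
      distribute = solve-∀
      collect : ∀ t → 2 * (2 * t) + 2 * t ≡ 6 * t
      collect = solve-∀

    regroup : ∀ b X → 30 * b * (30 * b) * X ≡ 900 * (b * (b * X))
    regroup = solve-∀
    regroup′ : ∀ b K L → 900 * (b * (K * (4 * L))) ≡ 3600 * (b * K) * L
    regroup′ = solve-∀
    regroup″ : ∀ n L → 3600 * (6 * (2 * n)) * L ≡ 43200 * n * L
    regroup″ = solve-∀

  ∑S≤LM+tail : ∀ M → ∑ H S ≤ L * M + segSum exceeding M (t ∸ M)
  ∑S≤LM+tail M = begin
    ∑ H S                                                     ≤⟨ ∑-mono H S≤ ⟩
    ∑ H (λ h → M + segSum (λ ℓ → 𝟙 (ℓ <? S h)) M (t ∸ M))     ≡⟨ ∑-distrib-+ H _ _ ⟩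
    ∑ H (λ _ → M) + ∑ H (λ h → segSum (λ ℓ → 𝟙 (ℓ <? S h)) M (t ∸ M))
                                                              ≡⟨ cong₂ _+_ (∑-const H M) (sym (segSum-∑ H (λ ℓ h → 𝟙 (ℓ <? S h)) M (t ∸ M))) ⟩
    L * M + segSum exceeding M (t ∸ M)                        ∎
    where
    open ≤-Reasoning
    S≤ : ∀ h → S h ≤ M + segSum (λ ℓ → 𝟙 (ℓ <? S h)) M (t ∸ M)
    S≤ h = ≤-+-count-above (S h) M (t ∸ M) (≤-trans (scanTime≤fuel (build h keys) (h q) t) (m≤n+m∸n t M))

  M*tail≤C₁nL : ∀ M → 15 ≤ M → M * segSum exceeding (suc M) (t ∸ suc M) ≤ C₁ * n * L
  M*tail≤C₁nL M 15≤M = tail-≤ (t ∸ suc M) M (C₁ * n * L) exceeding λ i i<R →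
    ℓ²*exceeding≤C₁nL (suc M + i) (≤-trans 15≤M (≤-trans (n≤1+n M) (m≤m+n (suc M) i))) (m<o∸n⇒n+m<o i (suc M) t i<R)

  ∑S²≤CnL² : ∑ H S * ∑ H S ≤ (272 + C₁) * (272 + C₁) * n * (L * L)
  ∑S²≤CnL² = via-√ ⌊√ n ⌋
    where
    via-√ : (∃ λ m → m * m ≤ n × n < suc m * suc m) → ∑ H S * ∑ H S ≤ (272 + C₁) * (272 + C₁) * n * (L * L)
    via-√ (m , m²≤n , n<[m+1]²) =
      square-bound C₁ m n L (∑ H S) (segSum exceeding (suc (m + 15)) (t ∸ suc (m + 15))) m²≤n n<[m+1]²
                   (suc≡2*n⇒0<n n t≡2n) (∑S≤LM+tail (suc (m + 15))) (M*tail≤C₁nL (m + 15) (m≤n+m 15 m))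

mainTheorem2 : ∃ λ (C : ℕ) →
    (n u : ℕ) → 1 ≤ n →
    (H : Family u (2 * n)) → TwoIndependent H →
    (keys : List (Fin u)) → length keys ≡ n → Unique keys →
    (q : Fin u) → q ∉ keys →
    totalSearchTime H keys q * totalSearchTime H keys q
      ≤ C * n * (length H * length H)
-- The bound holds for a search started from any cell.
mainTheorem2 = (272 + C₁) * (272 + C₁) , λ where
  (suc n) u _ H indep keys |keys|≡n unique q _ →
    SearchTail.∑S²≤CnL² (suc n) (n + 1 * suc n) refl H indep keys |keys|≡n unique q
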